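{- Let $G$ be a nice graph in which no two adjacent vertices have the same degree. If $G$ has an interval coloring, then $\chi'_{qm\Sigma}(G)=2$.
   Context: All graphs are simple and finite. An interval coloring of $G$ is an edge-coloring with positive integers such that the colors of the edges incident to each vertex are pairwise distinct and form an interval of consecutive integers. A $k$-edge-coloring of $G$ is any map $c:E(G)\to[k]$ (adjacent edges may receive the same color). It induces $\sigma_c(v)=\sum_{u\in N(v)}c(vu)$. The coloring is neighbor sum distinguishing (NSD) if $\sigma_c(u)\ne\sigma_c(v)$ for every edge $uv$, and quasi-majority (QM) if every vertex $v$ is incident to at most $\lceil d(v)/2\rceil$ edges of each color. A graph is nice if it has no component isomorphic to $K_2$. $\chi'_{qm\Sigma}(G)$ is the minimum $k$ such that the nice graph $G$ has a QM and NSD $k$-edge-coloring. -}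

module Defs where

open import Data.Nat using (ℕ; zero; suc; _+_; _≤_; _<_; ⌈_/2⌉)
open import Data.Fin using (Fin)
open import Data.List using (List; map; allFin; filter; length)
open import Data.Nat.ListAction using (sum)
open import Data.Bool using (Bool; true; false; if_then_else_)
open import Data.Product using (Σ; ∃; ∃-syntax; _×_; _,_)
open import Relation.Nullary using (¬_)
open import Relation.Binary.PropositionalEquality using (_≡_; _≢_)
open import Data.Nat using (_≟_)
open import Relation.Nullary.Decidable using (⌊_⌋)

record Graph : Set where
  field
    n     : ℕ
    adj   : Fin n → Fin n → Bool
    sym   : ∀ u v → adj u v ≡ adj v u
    irrefl : ∀ v → adj v v ≡ false

open Graph public

Vertex : Graph → Set
Vertex G = Fin (n G)

Adjacent : (G : Graph) → Vertex G → Vertex G → Set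
Adjacent G u v = adj G u v ≡ true

deg : (G : Graph) → Vertex G → ℕ
deg G v = length (filter (λ u → adj G v u ≡? true) (allFin (n G)))
  where
  open import Data.Bool.Properties using () renaming (_≟_ to _≡?_)

HasEdge : Graph → Set
HasEdge G = ∃[ u ] ∃[ v ] Adjacent G u v

-- nice: no connected component isomorphic to K₂, i.e. there is no edge uv
-- whose endpoints both have degree 1
Nice : Graph → Set
Nice G = ¬ (∃[ u ] ∃[ v ] (Adjacent G u v × deg G u ≡ 1 × deg G v ≡ 1))

-- An edge labelling: a symmetric function on pairs of vertices; only its
-- values on edges are relevant.
record EdgeLabelling (G : Graph) : Set where
  field
    col    : Vertex G → Vertex G → ℕ
    colSym : ∀ u v → col u v ≡ col v u

open EdgeLabelling public

IsKEdgeColoring : (G : Graph) → ℕ → EdgeLabelling G → Set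
IsKEdgeColoring G k c = ∀ u v → Adjacent G u v → 1 ≤ col c u v × col c u v ≤ k

σ : (G : Graph) → EdgeLabelling G → Vertex G → ℕ
σ G c v = sum (map (λ u → if adj G v u then col c v u else 0) (allFin (n G)))

IsNSD : (G : Graph) → EdgeLabelling G → Set
IsNSD G c = ∀ u v → Adjacent G u v → σ G c u ≢ σ G c v

colourCount : (G : Graph) → EdgeLabelling G → Vertex G → ℕ → ℕ
colourCount G c v j =
  length (filter (λ u → (adj G v u ≡? true) ×-dec (col c v u ≟ j)) (allFin (n G)))
  where
  open import Data.Bool.Properties using () renaming (_≟_ to _≡?_)
  open import Relation.Nullary.Decidable using (_×-dec_)

IsQM : (G : Graph) → EdgeLabelling G → Set
IsQM G c = ∀ v j → colourCount G c v j ≤ ⌈ deg G v /2⌉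

HasQMNSD : (G : Graph) → ℕ → Set
HasQMNSD G k = ∃[ c ] (IsKEdgeColoring G k c × IsQM G c × IsNSD G c)

ChiQMΣ≡ : Graph → ℕ → Set
ChiQMΣ≡ G k = HasQMNSD G k × (∀ m → m < k → ¬ HasQMNSD G m)

ColourAt : (G : Graph) → EdgeLabelling G → Vertex G → ℕ → Set
ColourAt G c v m = ∃[ u ] (Adjacent G v u × col c v u ≡ m)

IsInterval : (ℕ → Set) → Set
IsInterval S = ∀ x y z → S x → S z → x ≤ y → y ≤ z → S y

IsIntervalColoring : (G : Graph) → EdgeLabelling G → Set
IsIntervalColoring G c =
  (∀ u v → Adjacent G u v → 1 ≤ col c u v)
  × (∀ v u w → Adjacent G v u → Adjacent G v w → u ≢ w → col c v u ≢ col c v w)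
  × (∀ v → IsInterval (ColourAt G c v))

HasIntervalColoring : Graph → Set
HasIntervalColoring G = ∃[ c ] IsIntervalColoring G c

-- Recolour an interval colouring c by parity: colour 1 on edges with c odd, colour 2 on edges
-- with c even. At a vertex v of degree d the colours of c are d consecutive integers
-- a, a+1, …, a+d−1, so each parity occurs at most ⌈d/2⌉ times (quasi-majority) and the new
-- colour sum at v lies between d + ⌊d/2⌋ and d + ⌈d/2⌉. These windows are disjoint for distinct
-- d, so adjacent vertices, having distinct degrees, get distinct sums. Conversely one colour
-- cannot be quasi-majority at a vertex of degree ≥ 2, and a nice graph with an edge has one.
module Submission where

open import Defs hiding (sym)
open import Data.Bool using (Bool; true; false; if_then_else_)
open import Data.Bool.Properties using () renaming (_≟_ to _≟ᵇ_)
open import Data.Empty using (⊥-elim)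
open import Data.Fin using () renaming (_≟_ to _≟ᶠ_)
open import Data.List using (List; []; _∷_; map; allFin; filter; length)
open import Data.List.Extrema.Nat using (max; xs≤max)
open import Data.List.Membership.Propositional using (_∈_)
open import Data.List.Membership.Propositional.Properties using (∈-allFin; ∈-filter⁺; ∈-filter⁻; ∈-map⁺)
open import Data.List.Properties using (map-cong; filter-≐)
open import Data.List.Relation.Unary.All as All using (_∷_)
open import Data.List.Relation.Unary.AllPairs using (_∷_)
open import Data.List.Relation.Unary.Any using (here; there)
open import Data.List.Relation.Unary.Unique.Propositional using (Unique)
open import Data.List.Relation.Unary.Unique.Propositional.Properties using (allFin⁺; filter⁺)
open import Data.Nat using (ℕ; zero; suc; _+_; _*_; _≤_; _<_; z≤n; s≤s; _≟_; ⌊_/2⌋; ⌈_/2⌉)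
open import Data.Nat.ListAction using (sum)
open import Data.Nat.Properties
open import Algebra.Properties.CommutativeSemigroup +-commutativeSemigroup using (interchange)
open import Data.Product using (∃-syntax; _×_; _,_; proj₁; proj₂)
open import Data.Sum using (inj₁; inj₂)
open import Function using (_∘_)
open import Relation.Binary.PropositionalEquality using (_≡_; _≢_; refl; sym; trans; ≢-sym; cong; cong₂; subst; subst₂; module ≡-Reasoning)
open import Relation.Binary.Definitions using (tri<; tri≈; tri>)
open import Relation.Nullary using (Dec; does; ¬_)
open import Relation.Nullary.Decidable using (_×-dec_; dec-true; dec-false; decidable-stable)

indicator : {P : Set} → Dec P → ℕ
indicator P? = if does P? then 1 else 0

indicator-≟true : ∀ b → indicator (b ≟ᵇ true) ≡ (if b then 1 else 0)
indicator-≟true true  = refl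
indicator-≟true false = refl

indicator-≟true-×-dec : ∀ b {P : Set} (P? : Dec P) →
  indicator ((b ≟ᵇ true) ×-dec P?) ≡ (if b then indicator P? else 0)
indicator-≟true-×-dec true  P? = refl
indicator-≟true-×-dec false P? = refl

length-filter≡sum-indicator : ∀ {X : Set} {P : X → Set} (P? : ∀ x → Dec (P x)) (xs : List X) →
  length (filter P? xs) ≡ sum (map (indicator ∘ P?) xs)
length-filter≡sum-indicator P? [] = refl
length-filter≡sum-indicator P? (x ∷ xs) with does (P? x)
... | true  = cong suc (length-filter≡sum-indicator P? xs)
... | false = length-filter≡sum-indicator P? xs

∈⇒1≤length : ∀ {X : Set} {x : X} {xs : List X} → x ∈ xs → 1 ≤ length xs
∈⇒1≤length {xs = _ ∷ _} _ = s≤s z≤n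

1≤length⇒∃∈ : ∀ {X : Set} {xs : List X} → 1 ≤ length xs → ∃[ x ] x ∈ xs
1≤length⇒∃∈ {xs = x ∷ _} _ = x , here refl

Unique-constant⇒length≤1 : ∀ {X : Set} {xs : List X} → Unique xs →
  (∀ {x y} → x ∈ xs → y ∈ xs → x ≡ y) → length xs ≤ 1
Unique-constant⇒length≤1 {xs = []}        _                 _  = z≤n
Unique-constant⇒length≤1 {xs = _ ∷ []}    _                 _  = s≤s z≤n
Unique-constant⇒length≤1 {xs = _ ∷ _ ∷ _} ((x≢y ∷ _) ∷ _) eq =
  ⊥-elim (x≢y (eq (here refl) (there (here refl))))

sumBelow : ℕ → (ℕ → ℕ) → ℕ
sumBelow zero    f = 0
sumBelow (suc B) f = sumBelow B f + f B

sumBelow-cong : ∀ B {f g : ℕ → ℕ} → (∀ m → m < B → f m ≡ g m) → sumBelow B f ≡ sumBelow B g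
sumBelow-cong zero    eq = refl
sumBelow-cong (suc B) eq = cong₂ _+_ (sumBelow-cong B (λ m m<B → eq m (m<n⇒m<1+n m<B))) (eq B ≤-refl)

sumBelow-zero : ∀ B {f : ℕ → ℕ} → (∀ m → m < B → f m ≡ 0) → sumBelow B f ≡ 0
sumBelow-zero B eq = trans (sumBelow-cong B eq) (sumBelow-0 B)
  where
  sumBelow-0 : ∀ B → sumBelow B (λ _ → 0) ≡ 0
  sumBelow-0 zero    = refl
  sumBelow-0 (suc B) = cong (_+ 0) (sumBelow-0 B)

sumBelow-+ : ∀ B (f g : ℕ → ℕ) → sumBelow B (λ m → f m + g m) ≡ sumBelow B f + sumBelow B g
sumBelow-+ zero    f g = refl
sumBelow-+ (suc B) f g =
  trans (cong (_+ (f B + g B)) (sumBelow-+ B f g)) (interchange (sumBelow B f) (sumBelow B g) (f B) (g B))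

sumBelow-indicator : ∀ (h : ℕ → ℕ) {k} B → k < B → sumBelow B (λ m → h m * indicator (k ≟ m)) ≡ h k
sumBelow-indicator h {k} (suc B) k<1+B with m<1+n⇒m<n∨m≡n k<1+B
... | inj₁ k<B = begin
  sumBelow B _ + h B * indicator (k ≟ B) ≡⟨ cong₂ _+_ (sumBelow-indicator h B k<B) (miss B (<⇒≢ k<B)) ⟩
  h k + 0                                ≡⟨ +-identityʳ (h k) ⟩
  h k                                    ∎
  where open ≡-Reasoning
        miss : ∀ m → k ≢ m → h m * indicator (k ≟ m) ≡ 0
        miss m k≢m rewrite dec-false (k ≟ m) k≢m = *-zeroʳ (h m)
... | inj₂ refl = begin
  sumBelow k _ + h k * indicator (k ≟ k) ≡⟨ cong₂ _+_ (sumBelow-zero k miss) hit ⟩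
  0 + h k                                ≡⟨⟩
  h k                                    ∎
  where open ≡-Reasoning
        miss : ∀ m → m < k → h m * indicator (k ≟ m) ≡ 0
        miss m m<k rewrite dec-false (k ≟ m) (≢-sym (<⇒≢ m<k)) = *-zeroʳ (h m)
        hit : h k * indicator (k ≟ k) ≡ h k
        hit rewrite dec-true (k ≟ k) refl = *-identityʳ (h k)

sumWhere : {X : Set} → (X → Bool) → (X → ℕ) → List X → ℕ
sumWhere p g xs = sum (map (λ x → if p x then g x else 0) xs)

sumWhere-fibres : ∀ {X : Set} (p : X → Bool) (f : X → ℕ) (h : ℕ → ℕ) {B} → (∀ x → f x < B) →
  ∀ xs → sumWhere p (h ∘ f) xs ≡ sumBelow B (λ m → h m * sumWhere p (λ x → indicator (f x ≟ m)) xs)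
sumWhere-fibres p f h {B} f<B [] = sym (sumBelow-zero B (λ m _ → *-zeroʳ (h m)))
sumWhere-fibres p f h {B} f<B (x ∷ xs) = begin
  (if p x then h (f x) else 0) + sumWhere p (h ∘ f) xs
    ≡⟨ cong₂ _+_ (single (p x)) (sumWhere-fibres p f h f<B xs) ⟩
  sumBelow B (λ m → h m * fibreˣ m) + sumBelow B (λ m → h m * fibre m)
    ≡⟨ sumBelow-+ B _ _ ⟨
  sumBelow B (λ m → h m * fibreˣ m + h m * fibre m)
    ≡⟨ sumBelow-cong B (λ m _ → *-distribˡ-+ (h m) (fibreˣ m) (fibre m)) ⟨
  sumBelow B (λ m → h m * (fibreˣ m + fibre m))
    ∎
  where
  open ≡-Reasoning
  fibreˣ fibre : ℕ → ℕ
  fibreˣ m = if p x then indicator (f x ≟ m) else 0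
  fibre m = sumWhere p (λ y → indicator (f y ≟ m)) xs
  single : ∀ b → (if b then h (f x) else 0) ≡ sumBelow B (λ m → h m * (if b then indicator (f x ≟ m) else 0))
  single true  = sym (sumBelow-indicator h B (f<B x))
  single false = sym (sumBelow-zero B (λ m _ → *-zeroʳ (h m)))

run : (ℕ → ℕ) → ℕ → ℕ → ℕ
run h a zero    = 0
run h a (suc d) = h a + run h (suc a) d

run-∷ʳ : ∀ h a d → run h a (suc d) ≡ run h a d + h (a + d)
run-∷ʳ h a zero = trans (+-identityʳ (h a)) (cong h (sym (+-identityʳ a)))
run-∷ʳ h a (suc d) = begin
  h a + run h (suc a) (suc d)          ≡⟨ cong (h a +_) (run-∷ʳ h (suc a) d) ⟩
  h a + (run h (suc a) d + h (suc a + d)) ≡⟨ +-assoc (h a) _ _ ⟨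
  run h a (suc d) + h (suc a + d)      ≡⟨ cong (λ k → run h a (suc d) + h k) (+-suc a d) ⟨
  run h a (suc d) + h (a + suc d)      ∎
  where open ≡-Reasoning

run-pairs : ∀ h → (∀ m → h (suc (suc m)) ≡ h m) → ∀ a d →
  run h a (suc (suc d)) ≡ (h a + h (suc a)) + run h a d
run-pairs h periodic a d =
  trans (sym (+-assoc (h a) (h (suc a)) _)) (cong ((h a + h (suc a)) +_) (shift a d))
  where
  shift : ∀ a d → run h (suc (suc a)) d ≡ run h a d
  shift a zero    = refl
  shift a (suc d) = cong₂ _+_ (periodic a) (shift (suc a) d)

-- Scanning B upwards, RunEnd B a d records that the support of N below B is [a, a + d): empty,
-- still open at B, or already closed (and then, by convexity, closed for good).
module IntervalSupport (N : ℕ → ℕ) (N≤1 : ∀ m → N m ≤ 1)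
  (convex : ∀ {x y z} → x ≤ y → y ≤ z → N x ≡ 1 → N z ≡ 1 → N y ≡ 1) where

  data RunEnd (B a d : ℕ) : Set where
    empty   : d ≡ 0 → RunEnd B a d
    ongoing : N a ≡ 1 → a + d ≡ B → RunEnd B a d
    closed  : N a ≡ 1 → a + d < B → N (a + d) ≡ 0 → RunEnd B a d

  RunBelow : ℕ → ℕ → Set
  RunBelow B a = (∀ h → sumBelow B (λ m → h m * N m) ≡ run h a (sumBelow B N)) × RunEnd B a (sumBelow B N)

  runBelow-absent : ∀ {B a} → N B ≡ 0 → RunBelow B a → RunBelow (suc B) a
  runBelow-absent {B} {a} NB≡0 (sums , end) =
    (λ h → trans (weighted h) (trans (sums h) (cong (run h a) (sym count))))
    , subst (RunEnd (suc B) a) (sym count) (extend end)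
    where
    count : sumBelow (suc B) N ≡ sumBelow B N
    count = trans (cong (sumBelow B N +_) NB≡0) (+-identityʳ _)
    weighted : ∀ h → sumBelow (suc B) (λ m → h m * N m) ≡ sumBelow B (λ m → h m * N m)
    weighted h = trans (cong (λ k → sumBelow B (λ m → h m * N m) + h B * k) NB≡0)
                       (trans (cong (sumBelow B (λ m → h m * N m) +_) (*-zeroʳ (h B))) (+-identityʳ _))
    extend : ∀ {d} → RunEnd B a d → RunEnd (suc B) a d
    extend (empty d≡0)               = empty d≡0
    extend (ongoing Na≡1 a+d≡B)      = closed Na≡1 (≤-reflexive (cong suc a+d≡B)) (trans (cong N a+d≡B) NB≡0)
    extend (closed Na≡1 a+d<B Nend≡0) = closed Na≡1 (m<n⇒m<1+n a+d<B) Nend≡0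

  private
    weighted-present : ∀ {B} → N B ≡ 1 → ∀ (h : ℕ → ℕ) →
      sumBelow (suc B) (λ m → h m * N m) ≡ sumBelow B (λ m → h m * N m) + h B
    weighted-present {B} NB≡1 h =
      cong (sumBelow B (λ m → h m * N m) +_) (trans (cong (h B *_) NB≡1) (*-identityʳ (h B)))

  runBelow-present : ∀ {B a} → N B ≡ 1 → RunBelow B a → ∃[ a′ ] RunBelow (suc B) a′
  runBelow-present {B} {a} NB≡1 (sums , empty d≡0) =
    B , (λ h → begin
          sumBelow (suc B) (λ m → h m * N m) ≡⟨ weighted-present {B} NB≡1 h ⟩
          sumBelow B (λ m → h m * N m) + h B ≡⟨ cong (_+ h B) (trans (sums h) (cong (run h a) d≡0)) ⟩
          h B                                ≡⟨ +-identityʳ (h B) ⟨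
          run h B 1                          ≡⟨ cong (run h B) count ⟨
          run h B (sumBelow (suc B) N)       ∎)
      , ongoing NB≡1 (trans (cong (B +_) count) (+-comm B 1))
    where
    open ≡-Reasoning
    count : sumBelow (suc B) N ≡ 1
    count = cong₂ _+_ d≡0 NB≡1
  runBelow-present {B} {a} NB≡1 (sums , ongoing Na≡1 a+d≡B) =
    a , (λ h → begin
          sumBelow (suc B) (λ m → h m * N m) ≡⟨ weighted-present {B} NB≡1 h ⟩
          sumBelow B (λ m → h m * N m) + h B ≡⟨ cong (_+ h B) (sums h) ⟩
          run h a d + h B                    ≡⟨ cong (λ k → run h a d + h k) a+d≡B ⟨
          run h a d + h (a + d)              ≡⟨ run-∷ʳ h a d ⟨
          run h a (suc d)                    ≡⟨ cong (run h a) count ⟨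
          run h a (sumBelow (suc B) N)       ∎)
      , ongoing Na≡1 (trans (cong (a +_) count) (trans (+-suc a d) (cong suc a+d≡B)))
    where
    open ≡-Reasoning
    d = sumBelow B N
    count : sumBelow (suc B) N ≡ suc d
    count = trans (cong (d +_) NB≡1) (+-comm d 1)
  runBelow-present {B} {a} NB≡1 (sums , closed Na≡1 a+d<B Nend≡0) =
    ⊥-elim (0≢1+n (trans (sym Nend≡0) (convex (m≤m+n a _) (<⇒≤ a+d<B) Na≡1 NB≡1)))

  runBelow : ∀ B → ∃[ a ] RunBelow B a
  runBelow zero = 0 , (λ _ → refl) , empty refl
  runBelow (suc B) with runBelow B | n≤1⇒n≡0∨n≡1 (N≤1 B)
  ... | a , r | inj₁ NB≡0 = a , runBelow-absent NB≡0 r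
  ... | a , r | inj₂ NB≡1 = runBelow-present NB≡1 r

  sumBelow-run : ∀ B → ∃[ a ] ∀ h → sumBelow B (λ m → h m * N m) ≡ run h a (sumBelow B N)
  sumBelow-run B with runBelow B
  ... | a , sums , _ = a , sums

incidentSum : (G : Graph) → Vertex G → (Vertex G → ℕ) → ℕ
incidentSum G v g = sumWhere (adj G v) g (allFin (n G))

deg≡incidentSum : ∀ G v → deg G v ≡ incidentSum G v (λ _ → 1)
deg≡incidentSum G v = trans (length-filter≡sum-indicator _ (allFin (n G)))
  (cong sum (map-cong (λ u → indicator-≟true (adj G v u)) (allFin (n G))))

colourCount≡incidentSum : ∀ G (c : EdgeLabelling G) v j →
  colourCount G c v j ≡ incidentSum G v (λ u → indicator (col c v u ≟ j))
colourCount≡incidentSum G c v j = trans (length-filter≡sum-indicator _ (allFin (n G)))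
  (cong sum (map-cong (λ u → indicator-≟true-×-dec (adj G v u) (col c v u ≟ j)) (allFin (n G))))

adjacent⇒1≤deg : ∀ G {u v} → Adjacent G v u → 1 ≤ deg G v
adjacent⇒1≤deg G {u} {v} vu = ∈⇒1≤length (∈-filter⁺ (λ w → adj G v w ≟ᵇ true) (∈-allFin u) vu)

module IntervalColouring (G : Graph) (c : EdgeLabelling G) (interval : IsIntervalColoring G c)
  (v : Vertex G) where

  private
    atColour : ∀ m u → Dec (adj G v u ≡ true × col c v u ≡ m)
    atColour m u = (adj G v u ≟ᵇ true) ×-dec (col c v u ≟ m)

  colourCount≤1 : ∀ m → colourCount G c v m ≤ 1
  colourCount≤1 m = Unique-constant⇒length≤1 (filter⁺ (atColour m) (allFin⁺ (n G))) same
    where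
    same : ∀ {x y} → x ∈ filter (atColour m) (allFin (n G)) → y ∈ filter (atColour m) (allFin (n G)) → x ≡ y
    same {x} {y} x∈ y∈
      with ∈-filter⁻ (atColour m) {xs = allFin (n G)} x∈ | ∈-filter⁻ (atColour m) {xs = allFin (n G)} y∈
    ... | _ , vx , cx≡m | _ , vy , cy≡m = decidable-stable (x ≟ᶠ y)
      (λ x≢y → proj₁ (proj₂ interval) v x y vx vy x≢y (trans cx≡m (sym cy≡m)))

  ColourAt⇒colourCount≡1 : ∀ {m} → ColourAt G c v m → colourCount G c v m ≡ 1
  ColourAt⇒colourCount≡1 {m} (u , vu , cu≡m) =
    ≤-antisym (colourCount≤1 m) (∈⇒1≤length (∈-filter⁺ (atColour m) (∈-allFin u) (vu , cu≡m)))

  colourCount≡1⇒ColourAt : ∀ {m} → colourCount G c v m ≡ 1 → ColourAt G c v m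
  colourCount≡1⇒ColourAt {m} count≡1 with 1≤length⇒∃∈ (≤-reflexive (sym count≡1))
  ... | u , u∈ = u , proj₂ (∈-filter⁻ (atColour m) {xs = allFin (n G)} u∈)

  colourCount-convex : ∀ {x y z} → x ≤ y → y ≤ z →
    colourCount G c v x ≡ 1 → colourCount G c v z ≡ 1 → colourCount G c v y ≡ 1
  colourCount-convex {x} {y} {z} x≤y y≤z x∈ z∈ = ColourAt⇒colourCount≡1
    (proj₂ (proj₂ interval) v x y z (colourCount≡1⇒ColourAt x∈) (colourCount≡1⇒ColourAt z∈) x≤y y≤z)

  private
    colours : List ℕ
    colours = map (col c v) (allFin (n G))
    B : ℕ
    B = suc (max 0 colours)
    col<B : ∀ u → col c v u < B
    col<B u = s≤s (All.lookup (xs≤max 0 colours) (∈-map⁺ (col c v) (∈-allFin u)))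

  incidentSum-fibres : ∀ h → incidentSum G v (h ∘ col c v) ≡ sumBelow B (λ m → h m * colourCount G c v m)
  incidentSum-fibres h = trans (sumWhere-fibres (adj G v) (col c v) h col<B (allFin (n G)))
    (sumBelow-cong B (λ m _ → cong (h m *_) (sym (colourCount≡incidentSum G c v m))))

  colours-form-run : ∃[ a ] ∀ h → incidentSum G v (h ∘ col c v) ≡ run h a (deg G v)
  colours-form-run with IntervalSupport.sumBelow-run (colourCount G c v) colourCount≤1 colourCount-convex B
  ... | a , runs = a , λ h → begin
    incidentSum G v (h ∘ col c v)                ≡⟨ incidentSum-fibres h ⟩
    sumBelow B (λ m → h m * colourCount G c v m) ≡⟨ runs h ⟩
    run h a (sumBelow B (colourCount G c v))     ≡⟨ cong (run h a) count≡deg ⟩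
    run h a (deg G v)                            ∎
    where
    open ≡-Reasoning
    count≡deg : sumBelow B (colourCount G c v) ≡ deg G v
    count≡deg = sym (trans (deg≡incidentSum G v)
      (trans (incidentSum-fibres (λ _ → 1)) (sumBelow-cong B (λ m _ → *-identityˡ (colourCount G c v m)))))

parityColour : ℕ → ℕ
parityColour zero          = 2
parityColour (suc zero)    = 1
parityColour (suc (suc m)) = parityColour m

parityColour∈[1,2] : ∀ m → 1 ≤ parityColour m × parityColour m ≤ 2
parityColour∈[1,2] zero          = s≤s z≤n , s≤s (s≤s z≤n)
parityColour∈[1,2] (suc zero)    = s≤s z≤n , s≤s z≤n
parityColour∈[1,2] (suc (suc m)) = parityColour∈[1,2] m

parityColour-+-suc : ∀ m → parityColour m + parityColour (suc m) ≡ 3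
parityColour-+-suc zero          = refl
parityColour-+-suc (suc zero)    = refl
parityColour-+-suc (suc (suc m)) = parityColour-+-suc m

parityColour-indicator-+-suc : ∀ j m → indicator (parityColour m ≟ j) + indicator (parityColour (suc m) ≟ j) ≤ 1
parityColour-indicator-+-suc j (suc (suc m))       = parityColour-indicator-+-suc j m
parityColour-indicator-+-suc zero          zero       = z≤n
parityColour-indicator-+-suc (suc zero)    zero       = s≤s z≤n
parityColour-indicator-+-suc (suc (suc zero)) zero    = s≤s z≤n
parityColour-indicator-+-suc (suc (suc (suc j))) zero = z≤n
parityColour-indicator-+-suc zero          (suc zero) = z≤n
parityColour-indicator-+-suc (suc zero)    (suc zero) = s≤s z≤n
parityColour-indicator-+-suc (suc (suc zero)) (suc zero) = s≤s z≤n
parityColour-indicator-+-suc (suc (suc (suc j))) (suc zero) = z≤n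

run-parityColour-indicator≤ : ∀ j a d → run (λ m → indicator (parityColour m ≟ j)) a d ≤ ⌈ d /2⌉
run-parityColour-indicator≤ j a zero = z≤n
run-parityColour-indicator≤ j a (suc zero) =
  ≤-trans (≤-reflexive (+-identityʳ _)) (≤-trans (m≤m+n _ _) (parityColour-indicator-+-suc j a))
run-parityColour-indicator≤ j a (suc (suc d)) = begin
  run h a (suc (suc d))         ≡⟨ run-pairs h (λ _ → refl) a d ⟩
  (h a + h (suc a)) + run h a d ≤⟨ +-mono-≤ (parityColour-indicator-+-suc j a) (run-parityColour-indicator≤ j a d) ⟩
  suc ⌈ d /2⌉                   ∎
  where
  open ≤-Reasoning
  h : ℕ → ℕ
  h m = indicator (parityColour m ≟ j)

NearThreeHalves : ℕ → ℕ → Set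
NearThreeHalves d s = d + ⌊ d /2⌋ ≤ s × s ≤ d + ⌈ d /2⌉

m<n⇒m+⌈m/2⌉<n+⌊n/2⌋ : ∀ {m n} → m < n → m + ⌈ m /2⌉ < n + ⌊ n /2⌋
m<n⇒m+⌈m/2⌉<n+⌊n/2⌋ m<n = +-mono-≤ m<n (⌊n/2⌋-mono m<n)

NearThreeHalves-injective : ∀ {d d′ s} → NearThreeHalves d s → NearThreeHalves d′ s → d ≡ d′
NearThreeHalves-injective {d} {d′} (lo , hi) (lo′ , hi′) with <-cmp d d′
... | tri< d<d′ _ _ = ⊥-elim (<⇒≱ (m<n⇒m+⌈m/2⌉<n+⌊n/2⌋ d<d′) (≤-trans lo′ hi))
... | tri≈ _ d≡d′ _ = d≡d′
... | tri> _ _ d′<d = ⊥-elim (<⇒≱ (m<n⇒m+⌈m/2⌉<n+⌊n/2⌋ d′<d) (≤-trans lo hi′))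

run-parityColour-NearThreeHalves : ∀ a d → NearThreeHalves d (run parityColour a d)
run-parityColour-NearThreeHalves a zero = z≤n , z≤n
run-parityColour-NearThreeHalves a (suc zero) =
  +-monoˡ-≤ 0 (proj₁ (parityColour∈[1,2] a)) , +-monoˡ-≤ 0 (proj₂ (parityColour∈[1,2] a))
run-parityColour-NearThreeHalves a (suc (suc d)) with run-parityColour-NearThreeHalves a d
... | lo , hi = subst₂ _≤_ (sym (shift ⌊ d /2⌋)) (sym pairs) (+-monoʳ-≤ 3 lo)
              , subst₂ _≤_ (sym pairs) (sym (shift ⌈ d /2⌉)) (+-monoʳ-≤ 3 hi)
  where
  shift : ∀ k → suc (suc d) + suc k ≡ 3 + (d + k)
  shift k = cong (suc ∘ suc) (+-suc d k)
  pairs : run parityColour a (suc (suc d)) ≡ 3 + run parityColour a d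
  pairs = trans (run-pairs parityColour (λ _ → refl) a d) (cong (_+ run parityColour a d) (parityColour-+-suc a))

parityRecolouring : ∀ {G} → EdgeLabelling G → EdgeLabelling G
parityRecolouring c = record
  { col    = λ u v → parityColour (col c u v)
  ; colSym = λ u v → cong parityColour (colSym c u v) }

module ParityRecolouring (G : Graph) (c : EdgeLabelling G) (interval : IsIntervalColoring G c) where

  is2EdgeColoring : IsKEdgeColoring G 2 (parityRecolouring c)
  is2EdgeColoring u v _ = parityColour∈[1,2] (col c u v)

  isQM : IsQM G (parityRecolouring c)
  isQM v j with IntervalColouring.colours-form-run G c interval v
  ... | a , runs = subst (_≤ ⌈ deg G v /2⌉)
    (sym (trans (colourCount≡incidentSum G (parityRecolouring c) v j) (runs _)))
    (run-parityColour-indicator≤ j a (deg G v))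

  σ-NearThreeHalves-deg : ∀ v → NearThreeHalves (deg G v) (σ G (parityRecolouring c) v)
  σ-NearThreeHalves-deg v with IntervalColouring.colours-form-run G c interval v
  ... | a , runs = subst (NearThreeHalves (deg G v)) (sym (runs parityColour))
    (run-parityColour-NearThreeHalves a (deg G v))

  isNSD : (∀ u v → Adjacent G u v → deg G u ≢ deg G v) → IsNSD G (parityRecolouring c)
  isNSD degrees-differ u v uv σu≡σv = degrees-differ u v uv (NearThreeHalves-injective
    (σ-NearThreeHalves-deg u) (subst (NearThreeHalves (deg G v)) (sym σu≡σv) (σ-NearThreeHalves-deg v)))

n≤⌈n/2⌉⇒n≤1 : ∀ n → n ≤ ⌈ n /2⌉ → n ≤ 1
n≤⌈n/2⌉⇒n≤1 zero          _ = z≤n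
n≤⌈n/2⌉⇒n≤1 (suc zero)    _ = ≤-refl
n≤⌈n/2⌉⇒n≤1 (suc (suc n)) n≤⌈n/2⌉ = ⊥-elim (<⇒≱ (⌈n/2⌉<n n) n≤⌈n/2⌉)

monochromatic-QM⇒deg≤1 : ∀ G (c : EdgeLabelling G) → IsKEdgeColoring G 1 c → IsQM G c → ∀ v → deg G v ≤ 1
monochromatic-QM⇒deg≤1 G c one qm v = n≤⌈n/2⌉⇒n≤1 (deg G v) (subst (_≤ ⌈ deg G v /2⌉) count≡deg (qm v 1))
  where
  count≡deg : colourCount G c v 1 ≡ deg G v
  count≡deg = cong length (filter-≐ (λ u → (adj G v u ≟ᵇ true) ×-dec (col c v u ≟ 1))
    (λ u → adj G v u ≟ᵇ true)
    (proj₁ , λ {u} vu → vu , ≤-antisym (proj₂ (one v u vu)) (proj₁ (one v u vu)))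
    (allFin (n G)))

QMNSD-needs-2 : ∀ G → Nice G → HasEdge G → ∀ k → k < 2 → ¬ HasQMNSD G k
QMNSD-needs-2 G nice (u , v , uv) zero _ (c , colouring , _) =
  1+n≰n (≤-trans (proj₁ (colouring u v uv)) (proj₂ (colouring u v uv)))
QMNSD-needs-2 G nice (u , v , uv) (suc zero) _ (c , colouring , qm , _) =
  nice (u , v , uv , deg≡1 uv , deg≡1 (trans (Graph.sym G v u) uv))
  where
  deg≡1 : ∀ {x y} → Adjacent G x y → deg G x ≡ 1
  deg≡1 {x} xy = ≤-antisym (monochromatic-QM⇒deg≤1 G c colouring qm x) (adjacent⇒1≤deg G xy)
QMNSD-needs-2 G _ _ (suc (suc _)) (s≤s (s≤s ())) _

mainTheorem17 : (G : Graph) → Nice G → HasEdge G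
    → (∀ u v → Adjacent G u v → deg G u ≢ deg G v)
    → HasIntervalColoring G
    → ChiQMΣ≡ G 2
mainTheorem17 G nice hasEdge degrees-differ (c , interval) =
  (parityRecolouring c , is2EdgeColoring , isQM , isNSD degrees-differ) , QMNSD-needs-2 G nice hasEdge
  where open ParityRecolouring G c interval
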